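{- Let $G$ be a finite graph containing at least one cycle, which has a difference-1 colouring, and let $H$ be the reduced form of $G$. Then for each vertex $v$ of $\mathrm{Sk}(H)$, the local tree of $H$ at $v$ consists either only of $v$, or of $v$ together with only leaves adjacent to $v$, or of $v$ together with only twigs whose bases are adjacent to $v$.
   Context: A colouring of a graph is a map from its edges to $\{\text{blue},\text{red}\}$; it is a difference-1 colouring if at every vertex the number of incident blue edges minus the number of incident red edges equals $1$. A leaf is a vertex of degree $1$. A twig is a vertex $b$ of degree $3$ (its base) with two leaves adjacent to $b$. A leaf-twig configuration at $v$ consists of four vertices distinct from $v$: a leaf $\ell$ and a twig with base $b$, with $\ell$ and $b$ both adjacent to $v$; removing it deletes these four vertices and their four incident edges. The reduced form of $G$ is obtained by repeatedly removing leaf-twig configurations until none remain. For a graph $K$ containing a cycle, the skeleton $\mathrm{Sk}(K)$ is the subgraph obtained by repeatedly deleting leaves (and incident edges) until none remain. For $v\in \mathrm{Sk}(K)$, the local tree of $K$ at $v$ is the connected component containing $v$ of the graph obtained from $K$ by deleting all edges of $\mathrm{Sk}(K)$. -}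

module Defs where

open import Data.Nat using (ℕ; zero; suc; _+_; _≤_)
open import Data.Bool using (Bool; true; false; _∧_; _∨_; not)
open import Data.Fin using (Fin; toℕ)
open import Data.Fin.Properties using (_≟_)
open import Data.List using (List; length; filterᵇ; allFin)
open import Data.Product using (Σ; ∃; ∃-syntax; _×_; _,_)
open import Data.Sum using (_⊎_)
open import Function.Definitions using (Injective)
open import Relation.Binary.PropositionalEquality using (_≡_; _≢_)
open import Relation.Nullary using (¬_)
open import Relation.Nullary.Decidable using (⌊_⌋)
open import Relation.Binary.Construct.Closure.ReflexiveTransitive using (Star)

record Graph (n : ℕ) : Set where
  field
    adj     : Fin n → Fin n → Bool
    adj-sym : ∀ x y → adj x y ≡ adj y x
    irrefl  : ∀ x → adj x x ≡ false

open Graph public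

-- Every graph considered below (G, its reduced form H,
-- the skeleton Sk(H)) is an induced subgraph of G given by a vertex subset:
-- removing a leaf-twig configuration or a leaf removes exactly the deleted
-- vertices together with all their incident edges.
VSet : ℕ → Set
VSet n = Fin n → Bool

full : ∀ {n} → VSet n
full _ = true

adjIn : ∀ {n} → Graph n → VSet n → Fin n → Fin n → Bool
adjIn G S x y = S x ∧ S y ∧ adj G x y

count : ∀ {n} → (Fin n → Bool) → ℕ
count {n} p = length (filterᵇ p (allFin n))

deg : ∀ {n} → Graph n → VSet n → Fin n → ℕ
deg G S x = count (adjIn G S x)

_─_ : ∀ {n} → VSet n → Fin n → VSet n
(S ─ u) x = S x ∧ not ⌊ x ≟ u ⌋

record Cycle {n : ℕ} (G : Graph n) : Set where
  field
    len     : ℕ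
    len≥3   : 3 ≤ len
    vtx     : Fin len → Fin n
    inj     : Injective _≡_ _≡_ vtx
    step    : ∀ (i j : Fin len) →
              (suc (toℕ i) ≡ toℕ j ⊎ (suc (toℕ i) ≡ len × toℕ j ≡ 0)) →
              adj G (vtx i) (vtx j) ≡ true

HasCycle : ∀ {n} → Graph n → Set
HasCycle G = Cycle G

-- Colourings: a colour (true = blue, false = red) for each edge.  An edge
-- is an unordered pair, so the colour function is required to be symmetric
-- on edges.

record Colouring {n : ℕ} (G : Graph n) : Set where
  field
    colour     : Fin n → Fin n → Bool
    colour-sym : ∀ x y → adj G x y ≡ true → colour x y ≡ colour y x

open Colouring public

blueDeg redDeg : ∀ {n} {G : Graph n} → Colouring G → Fin n → ℕ
blueDeg {G = G} c x = count (λ y → adj G x y ∧ colour c x y)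
redDeg  {G = G} c x = count (λ y → adj G x y ∧ not (colour c x y))

-- #blue − #red = 1 at every vertex (stated in ℕ as blue = red + 1)
IsDiff1 : ∀ {n} {G : Graph n} → Colouring G → Set
IsDiff1 {n} c = ∀ (x : Fin n) → blueDeg c x ≡ redDeg c x + 1

HasDiff1Colouring : ∀ {n} → Graph n → Set
HasDiff1Colouring G = Σ (Colouring G) IsDiff1

IsLeaf : ∀ {n} → Graph n → VSet n → Fin n → Set
IsLeaf G S x = S x ≡ true × deg G S x ≡ 1

IsTwig : ∀ {n} → Graph n → VSet n → (b l₁ l₂ : Fin n) → Set
IsTwig G S b l₁ l₂ =
  S b ≡ true × deg G S b ≡ 3 × l₁ ≢ l₂ ×
  IsLeaf G S l₁ × IsLeaf G S l₂ ×
  adjIn G S b l₁ ≡ true × adjIn G S b l₂ ≡ true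

record LeafTwig {n : ℕ} (G : Graph n) (S : VSet n) (v : Fin n) : Set where
  field
    ℓ b l₁ l₂ : Fin n
    vS        : S v ≡ true
    ℓ≢v       : ℓ ≢ v
    b≢v       : b ≢ v
    l₁≢v      : l₁ ≢ v
    l₂≢v      : l₂ ≢ v
    ℓ≢b       : ℓ ≢ b
    ℓ≢l₁      : ℓ ≢ l₁
    ℓ≢l₂      : ℓ ≢ l₂
    b≢l₁      : b ≢ l₁
    b≢l₂      : b ≢ l₂
    leaf      : IsLeaf G S ℓ
    twig      : IsTwig G S b l₁ l₂
    ℓ~v       : adjIn G S ℓ v ≡ true
    b~v       : adjIn G S b v ≡ true

record RemoveStep {n : ℕ} (G : Graph n) (S S' : VSet n) : Set where
  field
    v      : Fin n
    config : LeafTwig G S v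
    result : ∀ x → S' x ≡ ((((S ─ LeafTwig.ℓ config) ─ LeafTwig.b config)
                               ─ LeafTwig.l₁ config) ─ LeafTwig.l₂ config) x

IsReducedForm : ∀ {n} → Graph n → VSet n → Set
IsReducedForm {n} G S =
  Star (RemoveStep G) full S × (∀ (v : Fin n) → ¬ LeafTwig G S v)

record LeafStep {n : ℕ} (G : Graph n) (T T' : VSet n) : Set where
  field
    x      : Fin n
    isLeaf : IsLeaf G T x
    result : ∀ y → T' y ≡ (T ─ x) y

IsSkeleton : ∀ {n} → Graph n → VSet n → VSet n → Set
IsSkeleton {n} G S T =
  Star (LeafStep G) S T × (∀ (x : Fin n) → ¬ IsLeaf G T x)

-- Local tree of K = G[S] at v ∈ Sk(K) = G[T]: the component containing v
-- of the graph obtained from K by deleting all edges of Sk(K).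

adjLoc : ∀ {n} → Graph n → VSet n → VSet n → Fin n → Fin n → Bool
adjLoc G S T x y = adjIn G S x y ∧ not (adjIn G T x y)

data Reach {n : ℕ} (G : Graph n) (S T : VSet n) (v : Fin n) : Fin n → Set where
  here : S v ≡ true → Reach G S T v v
  next : ∀ {x y} → Reach G S T v x → adjLoc G S T x y ≡ true → Reach G S T v y

InLocalTree : ∀ {n} → Graph n → VSet n → VSet n → Fin n → Fin n → Set
InLocalTree G S T v u = Reach G S T v u

OnlyV : ∀ {n} → Graph n → VSet n → VSet n → Fin n → Set
OnlyV {n} G S T v = ∀ (u : Fin n) → InLocalTree G S T v u → u ≡ v

OnlyLeaves : ∀ {n} → Graph n → VSet n → VSet n → Fin n → Set
OnlyLeaves {n} G S T v =
  ∀ (u : Fin n) → InLocalTree G S T v u → u ≢ v →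
    IsLeaf G S u × adjIn G S u v ≡ true

IsTwigBaseAt : ∀ {n} → Graph n → VSet n → Fin n → Fin n → Set
IsTwigBaseAt G S v b =
  adjIn G S b v ≡ true × ∃[ l₁ ] ∃[ l₂ ] IsTwig G S b l₁ l₂

OnlyTwigs : ∀ {n} → Graph n → VSet n → VSet n → Fin n → Set
OnlyTwigs {n} G S T v =
  ∀ (u : Fin n) → InLocalTree G S T v u → u ≢ v →
    IsTwigBaseAt G S v u
    ⊎ (IsLeaf G S u × ∃[ b ] (adjIn G S u b ≡ true × IsTwigBaseAt G S v b))

LocalTreeShape : ∀ {n} → Graph n → VSet n → VSet n → Fin n → Set
LocalTreeShape G S T v = OnlyV G S T v ⊎ OnlyLeaves G S T v ⊎ OnlyTwigs G S T v

module Submission where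

-- The colouring restricted to H stays difference-1: an edge at a leaf is blue and the third edge
-- at a twig base is red, so removing a leaf-twig configuration at v takes one blue and one red
-- edge from v and changes no other surviving vertex. Along the leaf deletions producing Sk(H),
-- every deleted vertex is a leaf of H or the base of a twig of H whose two leaves are deleted too:
-- when a leaf x of the current graph, with remaining neighbour p, is deleted, its other neighbours
-- are already of this kind; a twig base among them next to a leaf would be a leaf-twig
-- configuration at x, and otherwise the colour count at x makes it a leaf or a twig base with xp
-- red. Hence the local tree at v consists of leaves adjacent to v or of twigs hanging from v,
-- and not of both, again because H has no leaf-twig configuration.

open import Defs
open import Data.Nat using (ℕ; zero; suc; _+_)
open import Data.Nat.Properties using (suc-injective; +-comm; +-identityʳ; +-suc; m+n≡0⇒m≡0; m+n≡0⇒n≡0)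
  renaming (_≟_ to _≟ℕ_)
open import Data.Bool using (Bool; true; false; _∧_; not; if_then_else_)
open import Data.Bool.Properties using (∧-zeroʳ; ∧-identityʳ; ¬-not; not-¬; not-injective)
  renaming (_≟_ to _≟ᵇ_)
open import Data.Fin using (Fin; zero; suc)
open import Data.Fin.Properties using (_≟_; any?; 0≢1+n) renaming (suc-injective to Fin-suc-injective)
open import Data.List using (length; filterᵇ; tabulate)
open import Data.Product using (∃; ∃₂; _×_; _,_; proj₁; proj₂)
open import Data.Sum using (_⊎_; inj₁; inj₂; [_,_]′)
open import Data.Empty using (⊥-elim)
open import Function using (id; _∘_; flip)
open import Relation.Binary.PropositionalEquality using (_≡_; _≢_; refl; sym; trans; cong; module ≡-Reasoning)
open import Relation.Nullary using (¬_; Dec; yes; no; contradiction)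
open import Relation.Nullary.Decidable using (⌊_⌋; _×-dec_)
open import Relation.Binary.Construct.Closure.ReflexiveTransitive using (Star; fold)

open ≡-Reasoning

private
  variable
    n : ℕ

∧-true⁻ : ∀ a {b} → a ∧ b ≡ true → a ≡ true × b ≡ true
∧-true⁻ true {true} _ = refl , refl

∧-true⁺ : ∀ {a b} → a ≡ true → b ≡ true → a ∧ b ≡ true
∧-true⁺ refl refl = refl

bool-ext : ∀ {a b} → (a ≡ true → b ≡ true) → (b ≡ true → a ≡ true) → a ≡ b
bool-ext {false} {false} _ _ = refl
bool-ext {false} {true}  _ g = g refl
bool-ext {true}  {false} f _ = sym (f refl)
bool-ext {true}  {true}  _ _ = refl

Star-preserves : ∀ {I : Set} {R : I → I → Set} (P : I → Set) →
  (∀ {i j} → R i j → P i → P j) → ∀ {i j} → Star R i j → P i → P j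
Star-preserves P step = fold (λ i j → P i → P j) (λ r k → k ∘ step r) id

bit : Bool → ℕ
bit b = if b then 1 else 0

bit≡suc⇒≡0 : ∀ b {r} → bit b ≡ suc r → r ≡ 0
bit≡suc⇒≡0 true  e = sym (suc-injective e)
bit≡suc⇒≡0 false ()

─-other : (p : Fin n → Bool) {a y : Fin n} → y ≢ a → (p ─ a) y ≡ p y
─-other p {a} {y} y≢a with y ≟ a
... | yes y≡a = contradiction y≡a y≢a
... | no  _   = ∧-identityʳ (p y)

─-true⁻ : (p : Fin n → Bool) {a y : Fin n} → (p ─ a) y ≡ true → p y ≡ true × y ≢ a
─-true⁻ p {a} {y} e with y ≟ a
... | yes _   = contradiction (trans (sym e) (∧-zeroʳ (p y))) λ ()
... | no  y≢a = trans (sym (∧-identityʳ (p y))) e , y≢a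

length-filterᵇ-tabulate : ∀ {A B : Set} (p : A → Bool) (q : B → Bool) (f : Fin n → A) (g : Fin n → B) →
  (∀ i → p (f i) ≡ q (g i)) → length (filterᵇ p (tabulate f)) ≡ length (filterᵇ q (tabulate g))
length-filterᵇ-tabulate {zero}  p q f g _ = refl
length-filterᵇ-tabulate {suc n} p q f g e with p (f zero) | q (g zero) | e zero
... | true  | true  | refl = cong suc (length-filterᵇ-tabulate p q (f ∘ suc) (g ∘ suc) (e ∘ suc))
... | false | false | refl = length-filterᵇ-tabulate p q (f ∘ suc) (g ∘ suc) (e ∘ suc)

count-cong : {p q : Fin n → Bool} → (∀ y → p y ≡ q y) → count p ≡ count q
count-cong {p = p} {q} = length-filterᵇ-tabulate p q id id

count-step : (p : Fin (suc n) → Bool) → count p ≡ bit (p zero) + count (p ∘ suc)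
count-step p with p zero
... | true  = cong suc (length-filterᵇ-tabulate p (p ∘ suc) suc id λ _ → refl)
... | false = length-filterᵇ-tabulate p (p ∘ suc) suc id λ _ → refl

count-empty : (p : Fin n → Bool) → (∀ y → p y ≡ false) → count p ≡ 0
count-empty {zero}  p _    = refl
count-empty {suc n} p none rewrite count-step p | none zero = count-empty (p ∘ suc) (none ∘ suc)

count-partition : (p c : Fin n → Bool) →
  count p ≡ count (λ y → p y ∧ c y) + count (λ y → p y ∧ not (c y))
count-partition {zero}  p c = refl
count-partition {suc n} p c
  rewrite count-step p | count-step (λ y → p y ∧ c y) | count-step (λ y → p y ∧ not (c y))
  with p zero | c zero
... | true  | true  = cong suc (count-partition (p ∘ suc) (c ∘ suc))
... | true  | false = trans (cong suc (count-partition (p ∘ suc) (c ∘ suc))) (sym (+-suc _ _))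
... | false | _     = count-partition (p ∘ suc) (c ∘ suc)

count-unique : (p : Fin n → Bool) {a : Fin n} → (∀ y → p y ≡ true → y ≡ a) → count p ≡ bit (p a)
count-unique {suc n} p {zero} only
  rewrite count-step p | count-empty (p ∘ suc) (λ y → ¬-not λ e → 0≢1+n (sym (only (suc y) e)))
  = +-identityʳ _
count-unique {suc n} p {suc a} only
  rewrite count-step p | ¬-not {p zero} (λ e → 0≢1+n (only zero e))
  = count-unique (p ∘ suc) (λ y e → Fin-suc-injective (only (suc y) e))

count-remove : (p : Fin n → Bool) (a : Fin n) → count p ≡ bit (p a) + count (p ─ a)
count-remove p a = begin
  count p                                        ≡⟨ count-partition p (λ y → ⌊ y ≟ a ⌋) ⟩
  count (λ y → p y ∧ ⌊ y ≟ a ⌋) + count (p ─ a) ≡⟨ cong (_+ count (p ─ a)) at-a ⟩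
  bit (p a) + count (p ─ a)                      ∎
  where
  only-a : ∀ y → p y ∧ ⌊ y ≟ a ⌋ ≡ true → y ≡ a
  only-a y e with y ≟ a
  ... | yes y≡a = y≡a
  ... | no  _   = contradiction (trans (sym e) (∧-zeroʳ (p y))) λ ()
  p-at-a : p a ∧ ⌊ a ≟ a ⌋ ≡ p a
  p-at-a with a ≟ a
  ... | yes _   = ∧-identityʳ (p a)
  ... | no  a≢a = contradiction refl a≢a
  at-a : count (λ y → p y ∧ ⌊ y ≟ a ⌋) ≡ bit (p a)
  at-a = trans (count-unique _ only-a) (cong bit p-at-a)

count-remove-true : (p : Fin n → Bool) {a : Fin n} → p a ≡ true → count p ≡ suc (count (p ─ a))
count-remove-true p {a} pa = trans (count-remove p a) (cong (λ b → bit b + count (p ─ a)) pa)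

count-remove-false : (p : Fin n → Bool) {a : Fin n} → p a ≡ false → count p ≡ count (p ─ a)
count-remove-false p {a} pa = trans (count-remove p a) (cong (λ b → bit b + count (p ─ a)) pa)

count-nonzero : (p : Fin n → Bool) {a : Fin n} → p a ≡ true → count p ≢ 0
count-nonzero p pa eq with () ← trans (sym (count-remove-true p pa)) eq

count-witness : (p : Fin n → Bool) → count p ≢ 0 → ∃ λ y → p y ≡ true
count-witness p nonzero with any? (λ y → p y ≟ᵇ true)
... | yes found = found
... | no  none  = contradiction (count-empty p (λ y → ¬-not λ e → none (y , e))) nonzero

count-differ-at : (p q : Fin n → Bool) {a : Fin n} → p a ≡ true → q a ≡ false →
  (∀ y → y ≢ a → p y ≡ q y) → count p ≡ suc (count q)
count-differ-at p q {a} pa qa agree = begin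
  count p             ≡⟨ count-remove-true p pa ⟩
  suc (count (p ─ a)) ≡⟨ cong suc (count-cong agree-off-a) ⟩
  suc (count (q ─ a)) ≡⟨ cong suc (count-remove-false q qa) ⟨
  suc (count q)       ∎
  where
  agree-off-a : ∀ y → (p ─ a) y ≡ (q ─ a) y
  agree-off-a y with y ≟ a
  ... | yes _   = trans (∧-zeroʳ (p y)) (sym (∧-zeroʳ (q y)))
  ... | no  y≢a = cong (_∧ true) (agree y y≢a)

count-drop : (p : Fin n → Bool) {a : Fin n} {k : ℕ} → count p ≡ suc k → p a ≡ true → count (p ─ a) ≡ k
count-drop p k+1 pa = suc-injective (trans (sym (count-remove-true p pa)) k+1)

count-cover₁ : (p : Fin n → Bool) {a d : Fin n} → count p ≡ 1 → p a ≡ true → p d ≡ true → d ≡ a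
count-cover₁ p {a} {d} one pa pd with d ≟ a
... | yes d≡a = d≡a
... | no  d≢a = contradiction (count-drop p one pa) (count-nonzero (p ─ a) (trans (─-other p d≢a) pd))

count-cover₂ : (p : Fin n → Bool) {a b d : Fin n} → count p ≡ 2 → p a ≡ true → p b ≡ true → a ≢ b →
  p d ≡ true → d ≡ a ⊎ d ≡ b
count-cover₂ p {a} {b} {d} two pa pb a≢b pd with d ≟ a
... | yes d≡a = inj₁ d≡a
... | no  d≢a = inj₂ (count-cover₁ (p ─ a) (count-drop p two pa)
                  (trans (─-other p (a≢b ∘ sym)) pb) (trans (─-other p d≢a) pd))

count-cover₃ : (p : Fin n → Bool) {a b c d : Fin n} → count p ≡ 3 →
  p a ≡ true → p b ≡ true → p c ≡ true → a ≢ b → a ≢ c → b ≢ c →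
  p d ≡ true → d ≡ a ⊎ d ≡ b ⊎ d ≡ c
count-cover₃ p {a} {b} {c} {d} three pa pb pc a≢b a≢c b≢c pd with d ≟ a
... | yes d≡a = inj₁ d≡a
... | no  d≢a = inj₂ (count-cover₂ (p ─ a) (count-drop p three pa)
                  (trans (─-other p (a≢b ∘ sym)) pb) (trans (─-other p (a≢c ∘ sym)) pc) b≢c
                  (trans (─-other p d≢a) pd))

count-pair : (p : Fin n → Bool) → count p ≡ 2 → ∃₂ λ a b → a ≢ b × p a ≡ true × p b ≡ true
count-pair p two with count-witness p (λ z → contradiction (trans (sym two) z) λ ())
... | a , pa with count-witness (p ─ a) (λ z → contradiction (trans (sym (count-drop p two pa)) z) λ ())
...   | b , pb with ─-true⁻ p pb
...     | pb′ , b≢a = a , b , b≢a ∘ sym , pa , pb′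

module _ (G : Graph n) where

  private
    variable
      x y z w : Fin n

  adjIn⁻ : ∀ S → adjIn G S x y ≡ true → S x ≡ true × S y ≡ true × adj G x y ≡ true
  adjIn⁻ {x} {y} S e with ∧-true⁻ (S x) e
  ... | x∈S , rest with ∧-true⁻ (S y) rest
  ...   | y∈S , xy = x∈S , y∈S , xy

  adjIn⁺ : ∀ S → S x ≡ true → S y ≡ true → adj G x y ≡ true → adjIn G S x y ≡ true
  adjIn⁺ S x∈S y∈S xy rewrite x∈S | y∈S = xy

  adjIn-sym : ∀ S → adjIn G S x y ≡ true → adjIn G S y x ≡ true
  adjIn-sym {x} {y} S e with adjIn⁻ S e
  ... | x∈S , y∈S , xy = adjIn⁺ S y∈S x∈S (trans (adj-sym G y x) xy)

  adjIn-irrefl : ∀ S → adjIn G S x y ≡ true → x ≢ y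
  adjIn-irrefl {x} S e refl = not-¬ (proj₂ (proj₂ (adjIn⁻ S e))) (irrefl G x)

  HasLeafNeighbour : VSet n → Fin n → Set
  HasLeafNeighbour S x = ∃ λ ℓ → adjIn G S x ℓ ≡ true × IsLeaf G S ℓ

  hasLeafNeighbour? : ∀ S x → Dec (HasLeafNeighbour S x)
  hasLeafNeighbour? S x = any? λ ℓ → (adjIn G S x ℓ ≟ᵇ true) ×-dec (S ℓ ≟ᵇ true) ×-dec (deg G S ℓ ≟ℕ 1)

  leaf-neighbour-unique : ∀ S → IsLeaf G S x → adjIn G S x y ≡ true → adjIn G S x z ≡ true → y ≡ z
  leaf-neighbour-unique {x} S (_ , one) xy xz = count-cover₁ (adjIn G S x) one xz xy

  leaf≢degree3 : ∀ S → IsLeaf G S x → deg G S y ≡ 3 → x ≢ y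
  leaf≢degree3 S (_ , one) three refl with () ← trans (sym one) three

  twig-leaf₁-neighbour : ∀ S {l₁ l₂} → IsTwig G S w l₁ l₂ → adjIn G S x l₁ ≡ true → x ≡ w
  twig-leaf₁-neighbour S (_ , _ , _ , leaf₁ , _ , w~l₁ , _) x~l₁ =
    leaf-neighbour-unique S leaf₁ (adjIn-sym S x~l₁) (adjIn-sym S w~l₁)

  twig-leaf₂-neighbour : ∀ S {l₁ l₂} → IsTwig G S w l₁ l₂ → adjIn G S x l₂ ≡ true → x ≡ w
  twig-leaf₂-neighbour S (_ , _ , _ , _ , leaf₂ , _ , w~l₂) x~l₂ =
    leaf-neighbour-unique S leaf₂ (adjIn-sym S x~l₂) (adjIn-sym S w~l₂)

  twig-neighbours : ∀ S {l₁ l₂} → IsTwig G S w l₁ l₂ → adjIn G S w x ≡ true → x ≢ l₁ → x ≢ l₂ →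
    adjIn G S w y ≡ true → y ≡ x ⊎ y ≡ l₁ ⊎ y ≡ l₂
  twig-neighbours {w} S (_ , three , l₁≢l₂ , _ , _ , w~l₁ , w~l₂) w~x x≢l₁ x≢l₂ =
    count-cover₃ (adjIn G S w) three w~x w~l₁ w~l₂ x≢l₁ x≢l₂ l₁≢l₂

  leafTwig : ∀ S {ℓ l₁ l₂} → S x ≡ true → IsLeaf G S ℓ → adjIn G S ℓ x ≡ true →
    IsTwig G S w l₁ l₂ → adjIn G S w x ≡ true → l₁ ≢ x → l₂ ≢ x → LeafTwig G S x
  leafTwig {w = w} S {ℓ} {l₁} {l₂} x∈S leaf ℓ~x twig@(_ , three , _ , leaf₁ , leaf₂ , _ , _)
           w~x l₁≢x l₂≢x =
    record
      { ℓ = ℓ ; b = w ; l₁ = l₁ ; l₂ = l₂ ; vS = x∈S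
      ; ℓ≢v = adjIn-irrefl S ℓ~x ; b≢v = adjIn-irrefl S w~x ; l₁≢v = l₁≢x ; l₂≢v = l₂≢x
      ; ℓ≢b = leaf≢degree3 S leaf three
      ; ℓ≢l₁ = λ { refl → adjIn-irrefl S w~x (sym (twig-leaf₁-neighbour S twig (adjIn-sym S ℓ~x))) }
      ; ℓ≢l₂ = λ { refl → adjIn-irrefl S w~x (sym (twig-leaf₂-neighbour S twig (adjIn-sym S ℓ~x))) }
      ; b≢l₁ = λ e → leaf≢degree3 S leaf₁ three (sym e)
      ; b≢l₂ = λ e → leaf≢degree3 S leaf₂ three (sym e)
      ; leaf = leaf ; twig = twig ; ℓ~v = ℓ~x ; b~v = w~x
      }

  module RemovalStep {S S′ : VSet n} (step : RemoveStep G S S′) where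
    open RemoveStep step public using (v)
    open LeafTwig (RemoveStep.config step) public

    survivor⁻ : S′ y ≡ true → S y ≡ true × y ≢ ℓ × y ≢ b × y ≢ l₁ × y ≢ l₂
    survivor⁻ {y} e with ─-true⁻ (((S ─ ℓ) ─ b) ─ l₁) (trans (sym (RemoveStep.result step y)) e)
    ... | e₃ , y≢l₂ with ─-true⁻ ((S ─ ℓ) ─ b) e₃
    ...   | e₂ , y≢l₁ with ─-true⁻ (S ─ ℓ) e₂
    ...     | e₁ , y≢b with ─-true⁻ S e₁
    ...       | y∈S , y≢ℓ = y∈S , y≢ℓ , y≢b , y≢l₁ , y≢l₂

    survivor⁺ : S y ≡ true → y ≢ ℓ → y ≢ b → y ≢ l₁ → y ≢ l₂ → S′ y ≡ true
    survivor⁺ {y} y∈S y≢ℓ y≢b y≢l₁ y≢l₂ = begin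
      S′ y                          ≡⟨ RemoveStep.result step y ⟩
      ((((S ─ ℓ) ─ b) ─ l₁) ─ l₂) y ≡⟨ ─-other (((S ─ ℓ) ─ b) ─ l₁) y≢l₂ ⟩
      (((S ─ ℓ) ─ b) ─ l₁) y        ≡⟨ ─-other ((S ─ ℓ) ─ b) y≢l₁ ⟩
      ((S ─ ℓ) ─ b) y               ≡⟨ ─-other (S ─ ℓ) y≢b ⟩
      (S ─ ℓ) y                     ≡⟨ ─-other S y≢ℓ ⟩
      S y                           ≡⟨ y∈S ⟩
      true                          ∎

    adjIn-unchanged : S′ x ≡ true → y ≢ ℓ → y ≢ b → adjIn G S′ x y ≡ adjIn G S x y
    adjIn-unchanged {x} {y} x∈S′ y≢ℓ y≢b = bool-ext restrict extend
      where
      restrict : adjIn G S′ x y ≡ true → adjIn G S x y ≡ true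
      restrict e with adjIn⁻ S′ e
      ... | x∈S′ , y∈S′ , xy = adjIn⁺ S (proj₁ (survivor⁻ x∈S′)) (proj₁ (survivor⁻ y∈S′)) xy
      extend : adjIn G S x y ≡ true → adjIn G S′ x y ≡ true
      extend e with survivor⁻ x∈S′ | adjIn⁻ S e
      ... | _ , _ , x≢b , _ , _ | _ , y∈S , xy = adjIn⁺ S′ x∈S′ (survivor⁺ y∈S y≢ℓ y≢b y≢l₁ y≢l₂) xy
        where
        y≢l₁ : y ≢ l₁
        y≢l₁ refl = x≢b (twig-leaf₁-neighbour S twig e)
        y≢l₂ : y ≢ l₂
        y≢l₂ refl = x≢b (twig-leaf₂-neighbour S twig e)

    ℓ-removed : adjIn G S′ x ℓ ≡ false
    ℓ-removed = ¬-not λ e → proj₁ (proj₂ (survivor⁻ (proj₁ (proj₂ (adjIn⁻ S′ e))))) refl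

    b-removed : adjIn G S′ x b ≡ false
    b-removed = ¬-not λ e → proj₁ (proj₂ (proj₂ (survivor⁻ (proj₁ (proj₂ (adjIn⁻ S′ e)))))) refl

    adjIn-unchanged-off-v : S′ x ≡ true → x ≢ v → ∀ y → adjIn G S′ x y ≡ adjIn G S x y
    adjIn-unchanged-off-v {x} x∈S′ x≢v y with y ≟ ℓ | y ≟ b | survivor⁻ x∈S′
    ... | yes refl | _        | _ = trans ℓ-removed (sym (¬-not λ x~ℓ →
          x≢v (leaf-neighbour-unique S leaf (adjIn-sym S x~ℓ) ℓ~v)))
    ... | no _     | yes refl | _ , _ , _ , x≢l₁ , x≢l₂ = trans b-removed (sym (¬-not λ x~b →
          [ x≢v , [ x≢l₁ , x≢l₂ ]′ ]′
            (twig-neighbours S twig b~v (l₁≢v ∘ sym) (l₂≢v ∘ sym) (adjIn-sym S x~b))))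
    ... | no y≢ℓ   | no y≢b   | _ = adjIn-unchanged x∈S′ y≢ℓ y≢b

  PrunedTwigBase : VSet n → VSet n → Fin n → Set
  PrunedTwigBase S T u = ∃₂ λ l₁ l₂ → IsTwig G S u l₁ l₂ × T l₁ ≡ false × T l₂ ≡ false

  Pruned : VSet n → VSet n → Fin n → Set
  Pruned S T u = IsLeaf G S u ⊎ PrunedTwigBase S T u

  PruningInvariant : VSet n → VSet n → Set
  PruningInvariant S T =
    (∀ y → T y ≡ true → S y ≡ true) × (∀ u → S u ≡ true → T u ≡ false → Pruned S T u)

  Pruned-antitone : ∀ {S T T′ u} → (∀ y → T′ y ≡ true → T y ≡ true) → Pruned S T u → Pruned S T′ u
  Pruned-antitone _     (inj₁ leaf)                      = inj₁ leaf
  Pruned-antitone {T = T} {T′} T′⊆T (inj₂ (l₁ , l₂ , twig , t₁ , t₂)) =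
    inj₂ (l₁ , l₂ , twig , shrink t₁ , shrink t₂)
    where
    shrink : ∀ {y} → T y ≡ false → T′ y ≡ false
    shrink {y} t = ¬-not λ t′ → not-¬ (T′⊆T y t′) t

  module _ (c : Colouring G) where

    blueIn redIn : VSet n → Fin n → Fin n → Bool
    blueIn S x y = adjIn G S x y ∧ colour c x y
    redIn  S x y = adjIn G S x y ∧ not (colour c x y)

    Diff1On : VSet n → Set
    Diff1On S = ∀ x → S x ≡ true → count (blueIn S x) ≡ count (redIn S x) + 1

    edge-colour-sym : ∀ S → adjIn G S x y ≡ true → colour c x y ≡ colour c y x
    edge-colour-sym {x} {y} S xy = colour-sym c x y (proj₂ (proj₂ (adjIn⁻ S xy)))

    diff1-degree : ∀ {S} → Diff1On S → S x ≡ true → deg G S x ≡ suc (count (redIn S x) + count (redIn S x))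
    diff1-degree {x} {S} d x∈S = begin
      deg G S x                                   ≡⟨ count-partition (adjIn G S x) (colour c x) ⟩
      count (blueIn S x) + count (redIn S x)      ≡⟨ cong (_+ count (redIn S x)) (d x x∈S) ⟩
      count (redIn S x) + 1 + count (redIn S x)   ≡⟨ cong (_+ count (redIn S x)) (+-comm _ 1) ⟩
      suc (count (redIn S x) + count (redIn S x)) ∎

    leaf-red≡0 : ∀ {S} → Diff1On S → IsLeaf G S x → count (redIn S x) ≡ 0
    leaf-red≡0 d (x∈S , one) = m+n≡0⇒m≡0 _ (suc-injective (trans (sym (diff1-degree d x∈S)) one))

    degree3-blue≡2 : ∀ {S} → Diff1On S → S x ≡ true → deg G S x ≡ 3 → count (blueIn S x) ≡ 2
    degree3-blue≡2 {x} d x∈S three =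
      trans (d x x∈S) (cong (_+ 1) (half (suc-injective (trans (sym (diff1-degree d x∈S)) three))))
      where
      half : ∀ {r} → r + r ≡ 2 → r ≡ 1
      half {1} _ = refl
      half {suc (suc r)} e with () ← m+n≡0⇒n≡0 r (suc-injective (suc-injective e))

    edge-to-leaf-blue : ∀ {S} → Diff1On S → IsLeaf G S y → adjIn G S x y ≡ true → colour c x y ≡ true
    edge-to-leaf-blue {y} {S = S} d leaf xy = trans (edge-colour-sym S xy) (¬-not λ red →
      count-nonzero (redIn S y) (∧-true⁺ (adjIn-sym S xy) (cong not red)) (leaf-red≡0 d leaf))

    edge-to-twig-base-red : ∀ {S l₁ l₂} → Diff1On S → IsTwig G S w l₁ l₂ → adjIn G S x w ≡ true →
      x ≢ l₁ → x ≢ l₂ → colour c x w ≡ false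
    edge-to-twig-base-red {w} {S = S} d (w∈S , three , l₁≢l₂ , leaf₁ , leaf₂ , w~l₁ , w~l₂) xw x≢l₁ x≢l₂ =
      trans (edge-colour-sym S xw) (¬-not λ blue →
        [ x≢l₁ , x≢l₂ ]′ (count-cover₂ (blueIn S w) (degree3-blue≡2 d w∈S three)
          (∧-true⁺ w~l₁ (edge-to-leaf-blue d leaf₁ w~l₁)) (∧-true⁺ w~l₂ (edge-to-leaf-blue d leaf₂ w~l₂))
          l₁≢l₂ (∧-true⁺ (adjIn-sym S xw) blue)))

    diff1-preserved : ∀ {S S′} → RemoveStep G S S′ → Diff1On S → Diff1On S′
    diff1-preserved {S} {S′} step d x x∈S′ with x ≟ RemovalStep.v step
    ... | no x≢v = begin
      count (blueIn S′ x)     ≡⟨ count-cong (λ y → cong (_∧ colour c x y) (unchanged y)) ⟩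
      count (blueIn S x)      ≡⟨ d x (proj₁ (survivor⁻ x∈S′)) ⟩
      count (redIn S x) + 1   ≡⟨ cong (_+ 1) (count-cong λ y → cong (_∧ not (colour c x y)) (unchanged y)) ⟨
      count (redIn S′ x) + 1  ∎
      where
      open RemovalStep step
      unchanged : ∀ y → adjIn G S′ x y ≡ adjIn G S x y
      unchanged = adjIn-unchanged-off-v x∈S′ x≢v
    ... | yes refl = suc-injective (begin
      suc (count (blueIn S′ v))  ≡⟨ blue-drop ⟨
      count (blueIn S v)         ≡⟨ d v vS ⟩
      count (redIn S v) + 1      ≡⟨ cong (_+ 1) red-drop ⟩
      suc (count (redIn S′ v)) + 1 ∎)
      where
      open RemovalStep step
      v~ℓ-blue : colour c v ℓ ≡ true
      v~ℓ-blue = edge-to-leaf-blue d leaf (adjIn-sym S ℓ~v)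
      v~b-red : colour c v b ≡ false
      v~b-red = edge-to-twig-base-red d twig (adjIn-sym S b~v) (l₁≢v ∘ sym) (l₂≢v ∘ sym)
      blue-drop : count (blueIn S v) ≡ suc (count (blueIn S′ v))
      blue-drop = count-differ-at (blueIn S v) (blueIn S′ v)
        (∧-true⁺ (adjIn-sym S ℓ~v) v~ℓ-blue) (cong (_∧ colour c v ℓ) ℓ-removed) agree
        where
        agree : ∀ y → y ≢ ℓ → blueIn S v y ≡ blueIn S′ v y
        agree y y≢ℓ with y ≟ b
        ... | yes refl = trans (cong (adjIn G S v y ∧_) v~b-red)
                           (trans (∧-zeroʳ _) (sym (cong (_∧ colour c v y) b-removed)))
        ... | no  y≢b  = cong (_∧ colour c v y) (sym (adjIn-unchanged x∈S′ y≢ℓ y≢b))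
      red-drop : count (redIn S v) ≡ suc (count (redIn S′ v))
      red-drop = count-differ-at (redIn S v) (redIn S′ v)
        (∧-true⁺ (adjIn-sym S b~v) (cong not v~b-red)) (cong (_∧ not (colour c v b)) b-removed) agree
        where
        agree : ∀ y → y ≢ b → redIn S v y ≡ redIn S′ v y
        agree y y≢b with y ≟ ℓ
        ... | yes refl = trans (cong (λ col → adjIn G S v y ∧ not col) v~ℓ-blue)
                           (trans (∧-zeroʳ _) (sym (cong (_∧ not (colour c v y)) ℓ-removed)))
        ... | no  y≢ℓ  = cong (_∧ not (colour c v y)) (sym (adjIn-unchanged x∈S′ y≢ℓ y≢b))

    reduction-diff1 : ∀ {S} → IsDiff1 c → Star (RemoveStep G) full S → Diff1On S
    reduction-diff1 diff1 reduction = Star-preserves Diff1On diff1-preserved reduction (λ x _ → diff1 x)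

    single-blue⇒no-red : ∀ {S} → Diff1On S → S x ≡ true → (∀ z → blueIn S x z ≡ true → z ≡ y) →
      count (redIn S x) ≡ 0
    single-blue⇒no-red {x} {y} {S} d x∈S only-y = bit≡suc⇒≡0 (blueIn S x y) (begin
      bit (blueIn S x y)      ≡⟨ count-unique (blueIn S x) only-y ⟨
      count (blueIn S x)      ≡⟨ d x x∈S ⟩
      count (redIn S x) + 1   ≡⟨ +-comm _ 1 ⟩
      suc (count (redIn S x)) ∎)

    module DeletedLeaf {S T : VSet n} (d : Diff1On S) (irreducible : ∀ x → ¬ LeafTwig G S x)
                       (inv : PruningInvariant S T) {x : Fin n} (leafT : IsLeaf G T x)
                       (not-leafS : deg G S x ≢ 1) where

      x∈S : S x ≡ true
      x∈S = proj₁ inv x (proj₁ leafT)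

      T-neighbour : ∃ λ p → adjIn G T x p ≡ true
      T-neighbour = count-witness (adjIn G T x) (λ none → contradiction (trans (sym (proj₂ leafT)) none) λ ())

      p : Fin n
      p = proj₁ T-neighbour

      x~p : adjIn G S x p ≡ true
      x~p with adjIn⁻ T (proj₂ T-neighbour)
      ... | _ , p∈T , xp = adjIn⁺ S x∈S (proj₁ inv p p∈T) xp

      inside-neighbour : adjIn G S x y ≡ true → T y ≡ true → y ≡ p
      inside-neighbour xy y∈T = leaf-neighbour-unique T leafT
        (adjIn⁺ T (proj₁ leafT) y∈T (proj₂ (proj₂ (adjIn⁻ S xy)))) (proj₂ T-neighbour)

      outside-neighbour : adjIn G S x y ≡ true → T y ≡ false → Pruned S T y
      outside-neighbour {y} xy y∉T = proj₂ inv y (proj₁ (proj₂ (adjIn⁻ S xy))) y∉T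

      x-not-a-leaf : IsLeaf G S y → x ≢ y
      x-not-a-leaf (_ , one) refl = not-leafS one

      edge-to-base-red : adjIn G S x y ≡ true → PrunedTwigBase S T y → colour c x y ≡ false
      edge-to-base-red xy (_ , _ , twig@(_ , _ , _ , leaf₁ , leaf₂ , _) , _) =
        edge-to-twig-base-red d twig xy (x-not-a-leaf leaf₁) (x-not-a-leaf leaf₂)

      -- A twig base next to x and a leaf next to x would form a leaf-twig configuration at x;
      -- without such a leaf, every edge at x other than xp is red, against the colour balance.
      outside-neighbours-are-leaves : adjIn G S x y ≡ true → T y ≡ false → IsLeaf G S y
      outside-neighbours-are-leaves xy y∉T with outside-neighbour xy y∉T
      ... | inj₁ leaf = leaf
      ... | inj₂ base@(_ , _ , twig@(_ , _ , _ , leaf₁ , leaf₂ , _) , _)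
        with hasLeafNeighbour? S x
      ...   | yes (_ , x~ℓ , leaf) =
                ⊥-elim (irreducible x (leafTwig S x∈S leaf (adjIn-sym S x~ℓ) twig (adjIn-sym S xy)
                                         (x-not-a-leaf leaf₁ ∘ sym) (x-not-a-leaf leaf₂ ∘ sym)))
      ...   | no  no-leaf = contradiction (single-blue⇒no-red d x∈S blue-only-at-p)
                              (count-nonzero (redIn S x) (∧-true⁺ xy (cong not (edge-to-base-red xy base))))
        where
        blue-only-at-p : ∀ z → blueIn S x z ≡ true → z ≡ p
        blue-only-at-p z blue with ∧-true⁻ (adjIn G S x z) blue | T z ≟ᵇ true
        ... | xz , _        | yes z∈T = inside-neighbour xz z∈T
        ... | xz , x~z-blue | no  z∉T with outside-neighbour xz (¬-not z∉T)
        ...   | inj₁ leaf = ⊥-elim (no-leaf (z , xz , leaf))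
        ...   | inj₂ base = ⊥-elim (not-¬ x~z-blue (edge-to-base-red xz base))

      red-only-at-p : ∀ z → redIn S x z ≡ true → z ≡ p
      red-only-at-p z red with ∧-true⁻ (adjIn G S x z) red | T z ≟ᵇ true
      ... | xz , _       | yes z∈T = inside-neighbour xz z∈T
      ... | xz , x~z-red | no  z∉T =
            ⊥-elim (not-¬ (edge-to-leaf-blue d (outside-neighbours-are-leaves xz (¬-not z∉T)) xz)
                          (not-injective x~z-red))

      red≡bit : count (redIn S x) ≡ bit (redIn S x p)
      red≡bit = count-unique (redIn S x) red-only-at-p

      x~p-red : colour c x p ≡ false
      x~p-red = ¬-not λ x~p-blue → not-leafS (begin
        deg G S x                                   ≡⟨ diff1-degree d x∈S ⟩
        suc (count (redIn S x) + count (redIn S x)) ≡⟨ cong (λ r → suc (r + r)) red≡bit ⟩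
        suc (bit (redIn S x p) + bit (redIn S x p)) ≡⟨ cong (λ r → suc (bit r + bit r)) (no-red x~p-blue) ⟩
        1                                           ∎)
        where
        no-red : colour c x p ≡ true → redIn S x p ≡ false
        no-red blue = trans (cong (λ col → adjIn G S x p ∧ not col) blue) (∧-zeroʳ _)

      red≡1 : count (redIn S x) ≡ 1
      red≡1 = trans red≡bit (cong bit (∧-true⁺ x~p (cong not x~p-red)))

      x-twig-base : PrunedTwigBase S T x
      x-twig-base = twig-from (count-pair (blueIn S x) (trans (d x x∈S) (cong (_+ 1) red≡1)))
        where
        three : deg G S x ≡ 3
        three = trans (diff1-degree d x∈S) (cong (λ r → suc (r + r)) red≡1)
        neighbour : ∀ {a} → blueIn S x a ≡ true → adjIn G S x a ≡ true
        neighbour blue = proj₁ (∧-true⁻ (adjIn G S x _) blue)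
        outside : ∀ {a} → blueIn S x a ≡ true → T a ≡ false
        outside blue = ¬-not λ a∈T → not-¬ (proj₂ (∧-true⁻ (adjIn G S x _) blue))
          (trans (cong (colour c x) (inside-neighbour (neighbour blue) a∈T)) x~p-red)
        leaf : ∀ {a} → blueIn S x a ≡ true → IsLeaf G S a
        leaf blue = outside-neighbours-are-leaves (neighbour blue) (outside blue)
        twig-from : (∃₂ λ a₁ a₂ → a₁ ≢ a₂ × blueIn S x a₁ ≡ true × blueIn S x a₂ ≡ true) →
                    PrunedTwigBase S T x
        twig-from (a₁ , a₂ , a₁≢a₂ , a₁-blue , a₂-blue) =
          a₁ , a₂ , (x∈S , three , a₁≢a₂ , leaf a₁-blue , leaf a₂-blue , neighbour a₁-blue , neighbour a₂-blue)
             , outside a₁-blue , outside a₂-blue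

    leaf-pruned : ∀ {S T} → Diff1On S → (∀ x → ¬ LeafTwig G S x) → PruningInvariant S T →
      IsLeaf G T x → Pruned S T x
    leaf-pruned {x} {S} d irreducible inv leafT with deg G S x ≟ℕ 1
    ... | yes one = inj₁ (proj₁ inv x (proj₁ leafT) , one)
    ... | no  not-leafS = inj₂ (DeletedLeaf.x-twig-base d irreducible inv leafT not-leafS)

    pruning-invariant : ∀ {S T} → Diff1On S → (∀ x → ¬ LeafTwig G S x) → Star (LeafStep G) S T →
      PruningInvariant S T
    pruning-invariant {S} d irreducible pruning =
      Star-preserves (PruningInvariant S) step pruning
        ((λ _ y∈S → y∈S) , λ u u∈S u∉S → ⊥-elim (not-¬ u∈S u∉S))
      where
      step : ∀ {T T′} → LeafStep G T T′ → PruningInvariant S T → PruningInvariant S T′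
      step {T} {T′} deletion inv@(T⊆S , outside) = (λ y y∈T′ → T⊆S y (T′⊆T y y∈T′)) , outside′
        where
        open LeafStep deletion renaming (x to deleted)
        T′⊆T : ∀ y → T′ y ≡ true → T y ≡ true
        T′⊆T y y∈T′ = proj₁ (─-true⁻ T (trans (sym (result y)) y∈T′))
        outside′ : ∀ u → S u ≡ true → T′ u ≡ false → Pruned S T′ u
        outside′ u u∈S u∉T′ with T u in u-in-T | u ≟ deleted
        ... | false | _        = Pruned-antitone T′⊆T (outside u u∈S u-in-T)
        ... | true  | yes refl = Pruned-antitone T′⊆T (leaf-pruned d irreducible inv isLeaf)
        ... | true  | no  u≢x  =
              ⊥-elim (not-¬ (trans (result u) (trans (─-other T u≢x) u-in-T)) u∉T′)

  module LocalTree {S T : VSet n} (irreducible : ∀ x → ¬ LeafTwig G S x)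
                   (inv : PruningInvariant S T) {v : Fin n} (v∈T : T v ≡ true) where

    local-edge⁻ : adjLoc G S T x y ≡ true → adjIn G S x y ≡ true × (T x ≡ true → T y ≡ false)
    local-edge⁻ {x} {y} e with ∧-true⁻ (adjIn G S x y) e
    ... | xy , not-T-edge = xy , λ x∈T → ¬-not λ y∈T →
          not-¬ (adjIn⁺ T x∈T y∈T (proj₂ (proj₂ (adjIn⁻ S xy)))) (not-injective not-T-edge)

    outside≢v : T y ≡ false → y ≢ v
    outside≢v t refl = not-¬ v∈T t

    from-v : adjLoc G S T v y ≡ true → adjIn G S v y ≡ true × Pruned S T y
    from-v {y} e with local-edge⁻ e
    ... | vy , off-T = vy , proj₂ inv y (proj₁ (proj₂ (adjIn⁻ S vy))) (off-T v∈T)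

    leaves-only : HasLeafNeighbour S v → Reach G S T v y → y ≡ v ⊎ (IsLeaf G S y × adjIn G S y v ≡ true)
    leaves-only _ (here _) = inj₁ refl
    leaves-only has-leaf@(_ , v~ℓ , ℓ-leaf) (next r e) with leaves-only has-leaf r
    ... | inj₂ (leaf , x~v) = inj₁ (leaf-neighbour-unique S leaf (proj₁ (local-edge⁻ e)) x~v)
    ... | inj₁ refl with from-v e
    ...   | v~y , inj₁ leaf = inj₂ (leaf , adjIn-sym S v~y)
    ...   | v~y , inj₂ (_ , _ , twig , t₁ , t₂) =
            ⊥-elim (irreducible v (leafTwig S (proj₁ (adjIn⁻ S v~y)) ℓ-leaf (adjIn-sym S v~ℓ)
                                    twig (adjIn-sym S v~y) (outside≢v t₁) (outside≢v t₂)))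

    TwigPart : Fin n → Set
    TwigPart u = (adjIn G S u v ≡ true × PrunedTwigBase S T u)
               ⊎ (IsLeaf G S u × ∃ λ w → adjIn G S u w ≡ true × adjIn G S w v ≡ true × PrunedTwigBase S T w)

    TwigPart⇒OnlyTwigs : TwigPart y →
      IsTwigBaseAt G S v y ⊎ (IsLeaf G S y × ∃ λ w → adjIn G S y w ≡ true × IsTwigBaseAt G S v w)
    TwigPart⇒OnlyTwigs (inj₁ (y~v , l₁ , l₂ , twig , _)) = inj₁ (y~v , l₁ , l₂ , twig)
    TwigPart⇒OnlyTwigs (inj₂ (leaf , w , y~w , w~v , l₁ , l₂ , twig , _)) =
      inj₂ (leaf , w , y~w , w~v , l₁ , l₂ , twig)

    twigs-only : ¬ HasLeafNeighbour S v → Reach G S T v y → y ≡ v ⊎ TwigPart y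
    twigs-only _ (here _) = inj₁ refl
    twigs-only no-leaf (next r e) with twigs-only no-leaf r
    ... | inj₁ refl with from-v e
    ...   | v~y , inj₁ leaf = ⊥-elim (no-leaf (_ , v~y , leaf))
    ...   | v~y , inj₂ base = inj₂ (inj₁ (adjIn-sym S v~y , base))
    twigs-only no-leaf (next {x} r e)
      | inj₂ (inj₁ (x~v , base@(_ , _ , twig@(_ , _ , _ , leaf₁ , leaf₂ , x~l₁ , x~l₂) , t₁ , t₂)))
      with twig-neighbours S twig x~v (outside≢v t₁ ∘ sym) (outside≢v t₂ ∘ sym) (proj₁ (local-edge⁻ e))
    ... | inj₁ refl        = inj₁ refl
    ... | inj₂ (inj₁ refl) = inj₂ (inj₂ (leaf₁ , x , adjIn-sym S x~l₁ , x~v , base))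
    ... | inj₂ (inj₂ refl) = inj₂ (inj₂ (leaf₂ , x , adjIn-sym S x~l₂ , x~v , base))
    twigs-only no-leaf (next r e) | inj₂ (inj₂ (leaf , w , x~w , w~v , base))
      with leaf-neighbour-unique S leaf (proj₁ (local-edge⁻ e)) x~w
    ... | refl = inj₂ (inj₁ (w~v , base))

  local-tree-shape : ∀ {S T v} → (∀ x → ¬ LeafTwig G S x) → PruningInvariant S T → T v ≡ true →
    LocalTreeShape G S T v
  local-tree-shape {S} {T} {v} irreducible inv v∈T with hasLeafNeighbour? S v
  ... | yes has-leaf = inj₂ (inj₁ λ u r u≢v →
          [ flip contradiction u≢v , id ]′ (leaves-only has-leaf r))
    where open LocalTree irreducible inv v∈T
  ... | no  no-leaf  = inj₂ (inj₂ λ u r u≢v →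
          [ flip contradiction u≢v , TwigPart⇒OnlyTwigs ]′ (twigs-only no-leaf r))
    where open LocalTree irreducible inv v∈T

mainTheorem13 : ∀ (n : ℕ) (G : Graph n) →
    HasCycle G → HasDiff1Colouring G →
    ∀ (S : VSet n) → IsReducedForm G S →
    ∀ (T : VSet n) → IsSkeleton G S T →
    ∀ (v : Fin n) → T v ≡ true →
    LocalTreeShape G S T v
mainTheorem13 n G _ (c , diff1) S (reduction , irreducible) T (pruning , _) v v∈T =
  local-tree-shape G irreducible (pruning-invariant G c diff1-on-H irreducible pruning) v∈T
  where
  diff1-on-H : Diff1On G c S
  diff1-on-H = reduction-diff1 G c diff1 reduction
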